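{- Let $n > 3$ be a prime, and let $r \in \{1,2\}$ with $n \equiv r \pmod 3$. Suppose $a, b, m$ are integers with $m \ne 0$, $a + b \neq 0$, such that $p = \frac{a^n + b^n}{a+b}$ is an odd prime and $a + b = m^n$. Then $p \equiv 1 \pmod{2n}$, and for every positive integer $k$ with $k \equiv \frac{rn-1}{3} \pmod n$ there exist positive integers $A,B,C,D$ with $\gcd(A,B,C) = p^k$ satisfying $A + B = C$ and $ABC = D^n$. -}

module Defs where

open import Data.Nat using (ℕ)
open import Data.Nat.GCD using (gcd)

gcd3 : ℕ → ℕ → ℕ → ℕ
gcd3 x y z = gcd (gcd x y) z

module Submission where

-- (1) 2n ∣ p - 1.  Writing a = A d, b = B d with d = gcd(|a|, |b|) turns the hypothesis
--     into p = S d^(n-1), where A^n + B^n = S (A + B); so d = 1 and p divides neither a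
--     nor b.  Modulo p we have a^n ≡ (-b)^n and, by Fermat, a^(p-1) ≡ (-b)^(p-1), hence
--     a^g ≡ (-b)^g for g = gcd(n, p - 1) ∈ {1, n}.  The case g = 1 means p ∣ a + b = m^n,
--     so |a + b| ≥ p^n, which contradicts |a + b|^n ≤ 2^n |a^n + b^n| = 2^n |a + b| p.
--     Thus n ∣ p - 1, and 2n ∣ p - 1 because p is odd.
-- (2) The condition on k gives 3k + 1 = e n.  The identity a^n + b^n = m^n p, read with
--     absolute values, gives A + B = C with {A, B, C} = {|a|^n, |b|^n, |m|^n p}, coprime,
--     and ABC = |a b m|^n p; multiplying by p^k yields gcd p^k and product (p^e |a b m|)^n.

open import Data.Empty using (⊥-elim)
open import Data.Nat using (ℕ)
open import Data.Nat.Primality using (Prime)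
open import Data.Product using (_×_; _,_; ∃-syntax; proj₁; proj₂)
open import Data.Sum using (_⊎_; inj₁; inj₂; [_,_]′)
open import Function using (id; _∘_)
open import Relation.Nullary using (¬_)
open import Relation.Binary.PropositionalEquality

module Naturals where
  open import Data.Nat
  open import Data.Nat.Properties
  open import Data.Nat.Divisibility
  open import Data.Nat.DivMod using (_/_; _%_; m/n*n≡m; m≡m%n+[m/n]*n; m%n<n; m*n/n≡m; %-distribˡ-*)
  open import Data.Nat.Primality
  open import Data.Nat.Combinatorics using (_C_; k![n∸k]!∣n!)
  open import Data.Nat.Combinatorics.Specification using (nCk≡n!/k![n-k]!)
  open import Data.Nat.GCD using (gcd; gcd[m,n]∣m; gcd[m,n]∣n; c*gcd[m,n]≡gcd[cm,cn])
  open import Defs using (gcd3)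
  open import Data.Nat.Coprimality as Coprimality using (Coprime)
  open import Data.Nat.Tactic.RingSolver using (solve-∀)

  prime⇒1<p : ∀ {p} → Prime p → 1 < p
  prime⇒1<p {p} p-prime = nonTrivial⇒n>1 p {{prime⇒nonTrivial p-prime}}

  prime∤1 : ∀ {p} → Prime p → ¬ p ∣ 1
  prime∤1 p-prime p∣1 = <-irrefl (sym (∣1⇒≡1 p∣1)) (prime⇒1<p p-prime)

  Odd : ℕ → Set
  Odd n = ¬ 2 ∣ n

  odd⇒1+2j : ∀ n → Odd n → ∃[ j ] n ≡ suc (2 * j)
  odd⇒1+2j n 2∤n with n % 2 | m%n<n n 2 | m≡m%n+[m/n]*n n 2
  ... | 0 | _ | n≡[n/2]*2 = ⊥-elim (2∤n (divides (n / 2) n≡[n/2]*2))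
  ... | 1 | _ | n≡1+[n/2]*2 = n / 2 , trans n≡1+[n/2]*2 (cong suc (*-comm (n / 2) 2))
  ... | suc (suc _) | s≤s (s≤s ()) | _

  prime⇒odd : ∀ {n} → Prime n → 2 < n → Odd n
  prime⇒odd n-prime 2<n 2∣n with prime⇒irreducible n-prime 2∣n
  ... | inj₂ refl = <-irrefl refl 2<n

  odd⇒2∣pred : ∀ {n} → Odd n → 2 ∣ n ∸ 1
  odd⇒2∣pred {n} n-odd with odd⇒1+2j n n-odd
  ... | j , refl = m∣m*n j

  odd∣even⇒2*∣ : ∀ {n m} → Odd n → 2 ∣ m → n ∣ m → 2 * n ∣ m
  odd∣even⇒2*∣ {n} n-odd 2∣m (divides q refl) with Coprimality.coprime-divisor 2⊥n (subst (2 ∣_) (*-comm q n) 2∣m)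
    where
    2⊥n : Coprime 2 n
    2⊥n {d} (d∣2 , d∣n) = [ id , (λ { refl → ⊥-elim (n-odd d∣n) }) ]′ (prime⇒irreducible prime[2] d∣2)
  ... | divides q′ refl = divides q′ (*-assoc q′ 2 n)

  -- A prime has no divisor of the form d^k with k ≥ 2 other than 1: otherwise d = p
  -- and p^2 ∣ p.
  prime-power-divisor : ∀ {p d k} → Prime p → 2 ≤ k → d ^ k ∣ p → d ≡ 1
  prime-power-divisor {k = 0} _ () _
  prime-power-divisor {k = 1} _ (s≤s ()) _
  prime-power-divisor {p} {d} {suc (suc k)} p-prime _ dᵏ∣p
    with prime⇒irreducible p-prime (∣-trans (m∣m*n (d ^ suc k)) dᵏ∣p)
  ... | inj₁ d≡1 = d≡1
  ... | inj₂ refl = ⊥-elim (prime∤1 p-prime (*-cancelˡ-∣ p {{prime⇒nonZero p-prime}} p*p∣p*1))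
    where
    p*p∣p*1 : p * p ∣ p * 1
    p*p∣p*1 = subst₂ _∣_ refl (sym (*-identityʳ p))
      (∣-trans (subst (p * p ∣_) (*-assoc p p (p ^ k)) (m∣m*n (p ^ k))) dᵏ∣p)

  nCk*k![n∸k]!≡n! : ∀ {n k} → k ≤ n → (n C k) * (k ! * (n ∸ k) !) ≡ n !
  nCk*k![n∸k]!≡n! {n} {k} k≤n = trans (cong (_* (k ! * (n ∸ k) !)) (nCk≡n!/k![n-k]! k≤n))
    (m/n*n≡m {{k !* (n ∸ k) !≢0}} (k![n∸k]!∣n! k≤n))

  n∣n! : ∀ n .{{_ : NonZero n}} → n ∣ n !
  n∣n! (suc n) = m∣m*n (n !)

  prime∤! : ∀ {p} → Prime p → ∀ j → j < p → ¬ p ∣ j !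
  prime∤! p-prime zero _ = prime∤1 p-prime
  prime∤! p-prime (suc j) j<p p∣j! with euclidsLemma (suc j) (j !) p-prime p∣j!
  ... | inj₁ p∣1+j = <⇒≱ j<p (∣⇒≤ p∣1+j)
  ... | inj₂ p∣j!′ = prime∤! p-prime j (<-trans (n<1+n j) j<p) p∣j!′

  -- A prime p divides (p C k) for 0 < k < p: it divides p! = (p C k) k! (p - k)! but
  -- neither k! nor (p - k)!.
  prime∣pCk : ∀ {p k} → Prime p → 0 < k → k < p → p ∣ (p C k)
  prime∣pCk {p} {k} p-prime 0<k k<p
    with euclidsLemma (p C k) (k ! * (p ∸ k) !) p-prime p∣product
    where
    p∣product : p ∣ (p C k) * (k ! * (p ∸ k) !)
    p∣product = subst (p ∣_) (sym (nCk*k![n∸k]!≡n! (<⇒≤ k<p))) (n∣n! p {{prime⇒nonZero p-prime}})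
  ... | inj₁ p∣pCk = p∣pCk
  ... | inj₂ p∣factorials = ⊥-elim
    ([ prime∤! p-prime k k<p , prime∤! p-prime (p ∸ k) (∸-monoʳ-< 0<k (<⇒≤ k<p)) ]′
       (euclidsLemma (k !) ((p ∸ k) !) p-prime p∣factorials))

  *-positive : ∀ {x y} → 0 < x → 0 < y → 0 < x * y
  *-positive = *-mono-≤

  *-positive⁻¹ : ∀ x y → 0 < x * y → 0 < x × 0 < y
  *-positive⁻¹ zero y ()
  *-positive⁻¹ (suc x) zero 0<x*0 = ⊥-elim (<-irrefl refl (subst (0 <_) (*-zeroʳ x) 0<x*0))
  *-positive⁻¹ (suc x) (suc y) _ = z<s , z<s

  ^-positive : ∀ {x} → 0 < x → ∀ k → 0 < x ^ k
  ^-positive {x} 0<x k = m^n>0 x {{>-nonZero 0<x}} k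

  ^-distribʳ-* : ∀ x y k → (x * y) ^ k ≡ x ^ k * y ^ k
  ^-distribʳ-* x y zero = refl
  ^-distribʳ-* x y (suc k) =
    trans (cong ((x * y) *_) (^-distribʳ-* x y k)) (interchange x y (x ^ k) (y ^ k))
    where
    interchange : ∀ x y X Y → x * y * (X * Y) ≡ x * X * (y * Y)
    interchange = solve-∀

  cube*p≡^[3k+1] : ∀ p k → p ^ k * p ^ k * p ^ k * p ≡ p ^ (3 * k + 1)
  cube*p≡^[3k+1] p k = begin
    p ^ k * p ^ k * p ^ k * p    ≡⟨ as-powers (p ^ k) p ⟩
    (p ^ k) ^ 3 * p ^ 1          ≡⟨ cong (_* p ^ 1) (^-*-assoc p k 3) ⟩
    p ^ (k * 3) * p ^ 1          ≡⟨ ^-distribˡ-+-* p (k * 3) 1 ⟨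
    p ^ (k * 3 + 1)              ≡⟨ cong (λ t → p ^ (t + 1)) (*-comm k 3) ⟩
    p ^ (3 * k + 1)              ∎
    where
    open ≡-Reasoning
    as-powers : ∀ x p → x * x * x * p ≡ x * (x * (x * 1)) * (p * 1)
    as-powers = solve-∀

  ^-superadditive : ∀ k y z → y ^ suc k + z ^ suc k ≤ (y + z) ^ suc k
  ^-superadditive zero y z = ≤-reflexive (sym (*-distribʳ-+ 1 y z))
  ^-superadditive (suc k) y z = begin
    y ^ suc (suc k) + z ^ suc (suc k)
      ≤⟨ m≤m+n _ _ ⟩
    (y * y ^ suc k + z * z ^ suc k) + (y * z ^ suc k + z * y ^ suc k)
      ≡⟨ expand y z (y ^ suc k) (z ^ suc k) ⟩
    (y + z) * (y ^ suc k + z ^ suc k)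
      ≤⟨ *-monoʳ-≤ (y + z) (^-superadditive k y z) ⟩
    (y + z) ^ suc (suc k) ∎
    where
    open ≤-Reasoning
    expand : ∀ y z Y Z → (y * Y + z * Z) + (y * Z + z * Y) ≡ (y + z) * (Y + Z)
    expand = solve-∀

  ∸-^-≤ : ∀ k {x y} → y ≤ x → (x ∸ y) ^ suc k ≤ x ^ suc k ∸ y ^ suc k
  ∸-^-≤ k {x} {y} y≤x = m+n≤o⇒m≤o∸n ((x ∸ y) ^ suc k)
    (subst₂ _≤_ (+-comm (y ^ suc k) _) (cong (_^ suc k) (m+[n∸m]≡n y≤x)) (^-superadditive k y (x ∸ y)))

  ^-+-≤-ordered : ∀ k {y z} → y ≤ z → (y + z) ^ k ≤ 2 ^ k * (y ^ k + z ^ k)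
  ^-+-≤-ordered k {y} {z} y≤z = begin
    (y + z) ^ k             ≤⟨ ^-monoˡ-≤ k (+-monoˡ-≤ z y≤z) ⟩
    (z + z) ^ k             ≡⟨ cong (λ t → (z + t) ^ k) (sym (+-identityʳ z)) ⟩
    (2 * z) ^ k             ≡⟨ ^-distribʳ-* 2 z k ⟩
    2 ^ k * z ^ k           ≤⟨ *-monoʳ-≤ (2 ^ k) (m≤n+m (z ^ k) (y ^ k)) ⟩
    2 ^ k * (y ^ k + z ^ k) ∎
    where open ≤-Reasoning

  ^-+-≤ : ∀ k y z → (y + z) ^ k ≤ 2 ^ k * (y ^ k + z ^ k)
  ^-+-≤ k y z with ≤-total y z
  ... | inj₁ y≤z = ^-+-≤-ordered k y≤z
  ... | inj₂ z≤y = subst₂ (λ s t → s ^ k ≤ 2 ^ k * t)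
    (+-comm z y) (+-comm (z ^ k) (y ^ k)) (^-+-≤-ordered k z≤y)

  -- For p ≥ 2 and n ≥ 3, σ ≥ p^n rules out σ^n ≤ 2^n σ p: it would give
  -- σ σ ≤ 2^n p < p^n p^n ≤ σ σ.
  power-too-large : ∀ {σ p n} → 1 < p → 2 < n → p ^ n ≤ σ → ¬ σ ^ n ≤ 2 ^ n * (σ * p)
  power-too-large {σ} {p} {n} 1<p 2<n pⁿ≤σ σⁿ≤2ⁿσp = <⇒≱ 2ⁿp<σσ σσ≤2ⁿp
    where
    instance
      p≢0 : NonZero p
      p≢0 = >-nonZero (<-trans z<s 1<p)
      σ≢0 : NonZero σ
      σ≢0 = >-nonZero (<-≤-trans (m^n>0 p n) pⁿ≤σ)
    σσ≤2ⁿp : σ * σ ≤ 2 ^ n * p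
    σσ≤2ⁿp = *-cancelˡ-≤ σ (begin
      σ * (σ * σ)        ≡⟨ cong (λ t → σ * (σ * t)) (sym (*-identityʳ σ)) ⟩
      σ ^ 3              ≤⟨ ^-monoʳ-≤ σ 2<n ⟩
      σ ^ n              ≤⟨ σⁿ≤2ⁿσp ⟩
      2 ^ n * (σ * p)    ≡⟨ rearrange (2 ^ n) σ p ⟩
      σ * (2 ^ n * p)    ∎)
      where
      open ≤-Reasoning
      rearrange : ∀ a b c → a * (b * c) ≡ b * (a * c)
      rearrange = solve-∀
    2ⁿp<σσ : 2 ^ n * p < σ * σ
    2ⁿp<σσ = begin-strict
      2 ^ n * p          ≤⟨ *-monoˡ-≤ p (^-monoˡ-≤ n (1<p)) ⟩
      p ^ n * p          <⟨ *-monoʳ-< (p ^ n) {{m^n≢0 p n}} p<pⁿ ⟩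
      p ^ n * p ^ n      ≤⟨ *-mono-≤ pⁿ≤σ pⁿ≤σ ⟩
      σ * σ              ∎
      where
      open ≤-Reasoning
      p<pⁿ : p < p ^ n
      p<pⁿ = subst (_< p ^ n) (*-identityʳ p) (^-monoʳ-< p 1<p (<-trans (s<s z<s) 2<n))

  coprime-* : ∀ {x y z} → Coprime x y → Coprime x z → Coprime x (y * z)
  coprime-* {x} {y} x⊥y x⊥z {d} (d∣x , d∣yz) = x⊥z (d∣x , Coprimality.coprime-divisor d⊥y d∣yz)
    where
    d⊥y : Coprime d y
    d⊥y (e∣d , e∣y) = x⊥y (∣-trans e∣d d∣x , e∣y)

  coprime-^ʳ : ∀ {x y} → Coprime x y → ∀ k → Coprime x (y ^ k)
  coprime-^ʳ x⊥y zero (_ , d∣1) = ∣1⇒≡1 d∣1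
  coprime-^ʳ x⊥y (suc k) = coprime-* x⊥y (coprime-^ʳ x⊥y k)

  coprime-^ : ∀ {x y} → Coprime x y → ∀ k l → Coprime (x ^ k) (y ^ l)
  coprime-^ x⊥y k l = Coprimality.sym (coprime-^ʳ (Coprimality.sym (coprime-^ʳ x⊥y l)) k)

  gcd3∣ : ∀ x y z → gcd3 x y z ∣ x × gcd3 x y z ∣ y × gcd3 x y z ∣ z
  gcd3∣ x y z = ∣-trans (gcd[m,n]∣m (gcd x y) z) (gcd[m,n]∣m x y)
              , ∣-trans (gcd[m,n]∣m (gcd x y) z) (gcd[m,n]∣n x y)
              , gcd[m,n]∣n (gcd x y) z

  gcd3-* : ∀ c x y z → gcd3 (c * x) (c * y) (c * z) ≡ c * gcd3 x y z
  gcd3-* c x y z = begin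
    gcd (gcd (c * x) (c * y)) (c * z) ≡⟨ cong (λ g → gcd g (c * z)) (c*gcd[m,n]≡gcd[cm,cn] c x y) ⟨
    gcd (c * gcd x y) (c * z)         ≡⟨ c*gcd[m,n]≡gcd[cm,cn] c (gcd x y) z ⟨
    c * gcd (gcd x y) z               ∎
    where open ≡-Reasoning

  PowerTriple : ℕ → ℕ → Set
  PowerTriple g n = ∃[ A ] ∃[ B ] ∃[ C ] ∃[ D ] (1 ≤ A × 1 ≤ B × 1 ≤ C × 1 ≤ D
                      × gcd3 A B C ≡ g × A + B ≡ C × A * B * C ≡ D ^ n)

  3*[m∸1]/3+1 : ∀ m → m % 3 ≡ 1 → 3 * ((m ∸ 1) / 3) + 1 ≡ m
  3*[m∸1]/3+1 m m%3≡1 = begin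
    3 * ((m ∸ 1) / 3) + 1          ≡⟨ cong (λ t → 3 * ((t ∸ 1) / 3) + 1) m≡1+q*3 ⟩
    3 * ((q * 3) / 3) + 1          ≡⟨ cong (λ t → 3 * t + 1) (m*n/n≡m q 3) ⟩
    3 * q + 1                      ≡⟨ +-comm (3 * q) 1 ⟩
    1 + 3 * q                      ≡⟨ cong (1 +_) (*-comm 3 q) ⟩
    1 + q * 3                      ≡⟨ m≡1+q*3 ⟨
    m                              ∎
    where
    open ≡-Reasoning
    q : ℕ
    q = m / 3
    m≡1+q*3 : m ≡ 1 + q * 3
    m≡1+q*3 = trans (m≡m%n+[m/n]*n m 3) (cong (_+ q * 3) m%3≡1)

  r*n%3≡1 : ∀ n r → (r ≡ 1 ⊎ r ≡ 2) → n % 3 ≡ r → (r * n) % 3 ≡ 1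
  r*n%3≡1 n r (inj₁ refl) n%3≡1 = trans (cong (_% 3) (*-identityˡ n)) n%3≡1
  r*n%3≡1 n r (inj₂ refl) n%3≡2 = trans (%-distribˡ-* 2 n 3) (cong (λ t → (2 % 3 * t) % 3) n%3≡2)

module Integers where
  open import Data.Nat as ℕ using (ℕ; zero; suc)
  import Data.Nat.Properties as ℕ
  open import Data.Integer using (ℤ; +_; -[1+_]; 0ℤ; 1ℤ; _+_; _-_; -_; _*_; _^_; ∣_∣; _⊖_)
  open import Data.Integer.Properties
  open import Data.Integer.Divisibility.Signed
  open import Data.Integer.Tactic.RingSolver using (solve-∀)
  open import Data.Nat.Tactic.RingSolver using () renaming (solve-∀ to ℕ-solve-∀)
  import Data.Nat.Divisibility as ℕ
  import Data.Sum as Sum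
  open import Data.Nat.DivMod using (_/_; _%_)
  open Naturals using (Odd; odd⇒1+2j; ∸-^-≤; ^-+-≤; 3*[m∸1]/3+1; r*n%3≡1)

  pos-^ : ∀ x k → (+ x) ^ k ≡ + (x ℕ.^ k)
  pos-^ x zero = refl
  pos-^ x (suc k) = trans (cong (+ x *_) (pos-^ x k)) (sym (pos-* x (x ℕ.^ k)))

  abs-^ : ∀ x k → ∣ x ^ k ∣ ≡ ∣ x ∣ ℕ.^ k
  abs-^ x zero = refl
  abs-^ x (suc k) = trans (abs-* x (x ^ k)) (cong (∣ x ∣ ℕ.*_) (abs-^ x k))

  neg-^-1+2j : ∀ j u → (- u) ^ suc (2 ℕ.* j) ≡ - (u ^ suc (2 ℕ.* j))
  neg-^-1+2j zero u = neg-one u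
    where
    neg-one : ∀ u → - u * 1ℤ ≡ - (u * 1ℤ)
    neg-one = solve-∀
  neg-^-1+2j (suc j) u = begin
    (- u) ^ suc (2 ℕ.* suc j)         ≡⟨ cong ((- u) ^_) (cong suc (ℕ.*-suc 2 j)) ⟩
    - u * (- u * (- u) ^ suc (2 ℕ.* j)) ≡⟨ cong (λ t → - u * (- u * t)) (neg-^-1+2j j u) ⟩
    - u * (- u * - (u ^ suc (2 ℕ.* j))) ≡⟨ neg-three u (u ^ suc (2 ℕ.* j)) ⟩
    - (u * (u * u ^ suc (2 ℕ.* j)))     ≡⟨ cong (λ k → - (u ^ k)) (sym (cong suc (ℕ.*-suc 2 j))) ⟩
    - (u ^ suc (2 ℕ.* suc j))           ∎
    where
    open ≡-Reasoning
    neg-three : ∀ u v → - u * (- u * - v) ≡ - (u * (u * v))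
    neg-three = solve-∀

  neg-^-odd : ∀ {n} → Odd n → ∀ u → (- u) ^ n ≡ - (u ^ n)
  neg-^-odd {n} n-odd u with odd⇒1+2j n n-odd
  ... | j , refl = neg-^-1+2j j u

  sub∣pow-sub : ∀ x y k → x - y ∣ x ^ k - y ^ k
  sub∣pow-sub x y zero = divides 0ℤ refl
  sub∣pow-sub x y (suc k) = subst (x - y ∣_) (telescope x y (x ^ k) (y ^ k))
    (∣m∣n⇒∣m+n (∣n⇒∣m*n x (sub∣pow-sub x y k)) (∣m⇒∣m*n (y ^ k) ∣-refl))
    where
    telescope : ∀ x y X Y → x * (X - Y) + (x - y) * Y ≡ x * X - y * Y
    telescope = solve-∀

  sum∣odd-pow-sum : ∀ {n} → Odd n → ∀ a b → a + b ∣ a ^ n + b ^ n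
  sum∣odd-pow-sum {n} n-odd a b = subst₂ _∣_ (sub-neg a b) power-sum (sub∣pow-sub a (- b) n)
    where
    sub-neg : ∀ a b → a - - b ≡ a + b
    sub-neg = solve-∀
    power-sum : a ^ n - (- b) ^ n ≡ a ^ n + b ^ n
    power-sum = trans (cong (λ t → a ^ n - t) (neg-^-odd n-odd b))
      (cong (λ t → a ^ n + t) (neg-involutive (b ^ n)))

  ^-distribʳ-* : ∀ x y k → (x * y) ^ k ≡ x ^ k * y ^ k
  ^-distribʳ-* x y zero = refl
  ^-distribʳ-* x y (suc k) =
    trans (cong ((x * y) *_) (^-distribʳ-* x y k)) (interchange x y (x ^ k) (y ^ k))
    where
    interchange : ∀ x y X Y → x * y * (X * Y) ≡ x * X * (y * Y)
    interchange = solve-∀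

  ∣⊖∣-^-≤-ordered : ∀ k {x y} → x ℕ.≤ y →
                    ∣ x ⊖ y ∣ ℕ.^ suc k ℕ.≤ ∣ x ℕ.^ suc k ⊖ y ℕ.^ suc k ∣
  ∣⊖∣-^-≤-ordered k x≤y = subst₂ (λ s t → s ℕ.^ suc k ℕ.≤ t)
    (sym (∣⊖∣-≤ x≤y)) (sym (∣⊖∣-≤ (ℕ.^-monoˡ-≤ (suc k) x≤y))) (∸-^-≤ k x≤y)

  ∣⊖∣-^-≤ : ∀ k x y → ∣ x ⊖ y ∣ ℕ.^ suc k ℕ.≤ ∣ x ℕ.^ suc k ⊖ y ℕ.^ suc k ∣
  ∣⊖∣-^-≤ k x y with ℕ.≤-total x y
  ... | inj₁ x≤y = ∣⊖∣-^-≤-ordered k x≤y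
  ... | inj₂ y≤x = subst₂ (λ s t → s ℕ.^ suc k ℕ.≤ t)
    (∣m⊖n∣≡∣n⊖m∣ y x) (∣m⊖n∣≡∣n⊖m∣ (y ℕ.^ suc k) (x ℕ.^ suc k)) (∣⊖∣-^-≤-ordered k y≤x)

  -- For odd n: |a + b|^n ≤ 2^n |a^n + b^n|.  Both sides are symmetric in a and b and
  -- invariant under (a, b) ↦ (-a, -b), so only the sign patterns (+,+) and (+,-) remain.
  odd-power-sum-bound : ∀ {n} → Odd n → ∀ a b → ∣ a + b ∣ ℕ.^ n ℕ.≤ 2 ℕ.^ n ℕ.* ∣ a ^ n + b ^ n ∣
  odd-power-sum-bound {n} n-odd = bound
    where
    Bound : ℤ → ℤ → Set
    Bound a b = ∣ a + b ∣ ℕ.^ n ℕ.≤ 2 ℕ.^ n ℕ.* ∣ a ^ n + b ^ n ∣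

    swap : ∀ {a b} → Bound a b → Bound b a
    swap {a} {b} = subst₂ (λ s t → ∣ s ∣ ℕ.^ n ℕ.≤ 2 ℕ.^ n ℕ.* ∣ t ∣) (+-comm a b) (+-comm (a ^ n) (b ^ n))

    ∣-u+-v∣ : ∀ u v → ∣ - u + - v ∣ ≡ ∣ u + v ∣
    ∣-u+-v∣ u v = trans (cong ∣_∣ (sym (neg-distrib-+ u v))) (∣-i∣≡∣i∣ (u + v))

    negate : ∀ {a b} → Bound a b → Bound (- a) (- b)
    negate {a} {b} = subst₂ (λ s t → s ℕ.^ n ℕ.≤ 2 ℕ.^ n ℕ.* t) (sym (∣-u+-v∣ a b))
      (sym (trans (cong₂ (λ s t → ∣ s + t ∣) (neg-^-odd n-odd a) (neg-^-odd n-odd b)) (∣-u+-v∣ (a ^ n) (b ^ n))))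

    positive : ∀ x y → Bound (+ x) (+ y)
    positive x y = subst (λ t → (x ℕ.+ y) ℕ.^ n ℕ.≤ 2 ℕ.^ n ℕ.* ∣ t ∣)
      (sym (cong₂ _+_ (pos-^ x n) (pos-^ y n))) (^-+-≤ n x y)

    mixed : ∀ x y → Bound (+ x) (- + y)
    mixed x y with odd⇒1+2j n n-odd
    ... | j , refl = subst₂ (λ s t → ∣ s ∣ ℕ.^ n ℕ.≤ 2 ℕ.^ n ℕ.* ∣ t ∣)
      (sym (m-n≡m⊖n x y)) (sym power-difference)
      (ℕ.≤-trans (∣⊖∣-^-≤ (2 ℕ.* j) x y) (ℕ.m≤n*m _ (2 ℕ.^ n) {{ℕ.m^n≢0 2 n}}))
      where
      power-difference : (+ x) ^ n + (- + y) ^ n ≡ x ℕ.^ n ⊖ y ℕ.^ n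
      power-difference = trans (cong₂ _+_ (pos-^ x n) (trans (neg-^-odd n-odd (+ y)) (cong -_ (pos-^ y n))))
        (m-n≡m⊖n (x ℕ.^ n) (y ℕ.^ n))

    bound : ∀ a b → Bound a b
    bound (+ x)    (+ y)    = positive x y
    bound (+ x)    -[1+ y ] = mixed x (suc y)
    bound -[1+ x ] (+ y)    = swap (mixed y (suc x))
    bound -[1+ x ] -[1+ y ] = negate (positive (suc x) (suc y))

  ∣⊖∣-cases : ∀ x y → x ≡ y ℕ.+ ∣ x ⊖ y ∣ ⊎ y ≡ x ℕ.+ ∣ x ⊖ y ∣
  ∣⊖∣-cases x y with ℕ.≤-total y x
  ... | inj₁ y≤x =
    inj₁ (sym (trans (cong (y ℕ.+_) (trans (∣m⊖n∣≡∣n⊖m∣ x y) (∣⊖∣-≤ y≤x))) (ℕ.m+[n∸m]≡n y≤x)))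
  ... | inj₂ x≤y = inj₂ (sym (trans (cong (x ℕ.+_) (∣⊖∣-≤ x≤y)) (ℕ.m+[n∸m]≡n x≤y)))

  abs-sum-cases : ∀ u v → ∣ u + v ∣ ≡ ∣ u ∣ ℕ.+ ∣ v ∣
                        ⊎ ∣ u ∣ ≡ ∣ v ∣ ℕ.+ ∣ u + v ∣
                        ⊎ ∣ v ∣ ≡ ∣ u ∣ ℕ.+ ∣ u + v ∣
  abs-sum-cases (+ x)    (+ y)    = inj₁ refl
  abs-sum-cases (+ x)    -[1+ y ] = inj₂ (∣⊖∣-cases x (suc y))
  abs-sum-cases -[1+ x ] (+ y)    = inj₂ (Sum.swap (∣⊖∣-cases y (suc x)))
  abs-sum-cases -[1+ x ] -[1+ y ] = inj₁ (cong suc (sym (ℕ.+-suc x y)))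

  record SumTriple (u v : ℤ) : Set where
    field
      A B C : ℕ
      A+B≡C : A ℕ.+ B ≡ C
      ABC≡ : A ℕ.* B ℕ.* C ≡ ∣ u ∣ ℕ.* ∣ v ∣ ℕ.* ∣ u + v ∣
      common-divisor : ∀ {d} → d ℕ.∣ A → d ℕ.∣ B → d ℕ.∣ C → d ℕ.∣ ∣ u ∣ × d ℕ.∣ ∣ v ∣

  sum-triple : ∀ u v → SumTriple u v
  sum-triple u v with abs-sum-cases u v
  ... | inj₁ w≡u+v = record
    { A = ∣ u ∣ ; B = ∣ v ∣ ; C = ∣ u + v ∣ ; A+B≡C = sym w≡u+v ; ABC≡ = refl
    ; common-divisor = λ d∣u d∣v _ → d∣u , d∣v }
  ... | inj₂ (inj₁ u≡v+w) = record
    { A = ∣ v ∣ ; B = ∣ u + v ∣ ; C = ∣ u ∣ ; A+B≡C = sym u≡v+w ; ABC≡ = rotate (∣ u ∣) (∣ v ∣) (∣ u + v ∣)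
    ; common-divisor = λ d∣v _ d∣u → d∣u , d∣v }
    where
    rotate : ∀ x y z → y ℕ.* z ℕ.* x ≡ x ℕ.* y ℕ.* z
    rotate = ℕ-solve-∀
  ... | inj₂ (inj₂ v≡u+w) = record
    { A = ∣ u ∣ ; B = ∣ u + v ∣ ; C = ∣ v ∣ ; A+B≡C = sym v≡u+w ; ABC≡ = exchange (∣ u ∣) (∣ v ∣) (∣ u + v ∣)
    ; common-divisor = λ d∣u _ d∣v → d∣u , d∣v }
    where
    exchange : ∀ x y z → x ℕ.* z ℕ.* y ≡ x ℕ.* y ℕ.* z
    exchange = ℕ-solve-∀

  n∣3k+1 : ∀ n r k → (r ≡ 1 ⊎ r ≡ 2) → n % 3 ≡ r →
           + n ∣ + k - + ((r ℕ.* n ℕ.∸ 1) / 3) → n ℕ.∣ 3 ℕ.* k ℕ.+ 1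
  n∣3k+1 n r k r∈12 n%3≡r n∣k-c = ∣⇒∣ᵤ (subst (+ n ∣_) (sym 3k+1≡3[k-c]+rn)
    (∣m∣n⇒∣m+n (∣n⇒∣m*n (+ 3) n∣k-c) (∣n⇒∣m*n (+ r) ∣-refl)))
    where
    c : ℕ
    c = (r ℕ.* n ℕ.∸ 1) / 3
    pos-3x+1 : ∀ x → + (3 ℕ.* x ℕ.+ 1) ≡ + 3 * + x + 1ℤ
    pos-3x+1 x = trans (pos-+ (3 ℕ.* x) 1) (cong (_+ 1ℤ) (pos-* 3 x))
    split : ∀ k c → + 3 * k + 1ℤ ≡ + 3 * (k - c) + (+ 3 * c + 1ℤ)
    split = solve-∀
    3k+1≡3[k-c]+rn : + (3 ℕ.* k ℕ.+ 1) ≡ + 3 * (+ k - + c) + + r * + n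
    3k+1≡3[k-c]+rn = begin
      + (3 ℕ.* k ℕ.+ 1)                      ≡⟨ pos-3x+1 k ⟩
      + 3 * + k + 1ℤ                         ≡⟨ split (+ k) (+ c) ⟩
      + 3 * (+ k - + c) + (+ 3 * + c + 1ℤ)   ≡⟨ cong (λ t → + 3 * (+ k - + c) + t) (sym (pos-3x+1 c)) ⟩
      + 3 * (+ k - + c) + + (3 ℕ.* c ℕ.+ 1)  ≡⟨ cong (λ t → + 3 * (+ k - + c) + + t) 3c+1≡rn ⟩
      + 3 * (+ k - + c) + + (r ℕ.* n)        ≡⟨ cong (λ t → + 3 * (+ k - + c) + t) (pos-* r n) ⟩
      + 3 * (+ k - + c) + + r * + n          ∎
      where
      open ≡-Reasoning
      3c+1≡rn : 3 ℕ.* c ℕ.+ 1 ≡ r ℕ.* n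
      3c+1≡rn = 3*[m∸1]/3+1 (r ℕ.* n) (r*n%3≡1 n r r∈12 n%3≡r)

module Modular (p : ℕ) where
  open import Data.Nat as ℕ using (ℕ; zero; suc)
  import Data.Nat.Properties as ℕ
  import Data.Nat.Divisibility as ℕ
  open import Data.Nat.Primality using (euclidsLemma; prime⇒nonZero)
  open import Data.Nat.GCD using (gcd; module Bézout; gcd-GCD)
  open import Data.Nat.Combinatorics using (_C_; nCn≡1)
  open import Algebra.Bundles using (CommutativeSemiring)
  open import Data.Fin using (Fin; zero; suc; toℕ; fromℕ; inject₁)
  import Data.Fin.Properties as Fin
  open import Data.Vec.Functional using (Vector; tail)
  open import Data.Integer using (ℤ; +_; -[1+_]; 0ℤ; 1ℤ; _+_; _-_; -_; _*_; _^_; ∣_∣; +-0-rawMonoid)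
  open import Data.Integer.Properties
  open import Data.Integer.Divisibility.Signed
  open import Data.Integer.Tactic.RingSolver using (solve-∀)
  open import Relation.Binary.Bundles using (Setoid)
  import Relation.Binary.Reasoning.Setoid
  import Algebra.Properties.Semiring.Exp
  import Algebra.Definitions.RawMonoid
  import Algebra.Properties.CommutativeSemiring.Binomial +-*-commutativeSemiring as Binomial
  open Naturals using (prime∤1; prime∣pCk)

  infix 4 _≋_
  record _≋_ (x y : ℤ) : Set where
    constructor mod-p
    field p∣x-y : + p ∣ x - y
  open _≋_

  ≋-reflexive : ∀ {x y} → x ≡ y → x ≋ y
  ≋-reflexive {x} refl = mod-p (divides 0ℤ (+-inverseʳ x))

  ≋-refl : ∀ {x} → x ≋ x
  ≋-refl = ≋-reflexive refl

  ≋-sym : ∀ {x y} → x ≋ y → y ≋ x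
  ≋-sym {x} {y} (mod-p d) = mod-p (subst (+ p ∣_) (swap-sub x y) (∣m⇒∣-m d))
    where
    swap-sub : ∀ x y → - (x - y) ≡ y - x
    swap-sub = solve-∀

  ≋-trans : ∀ {x y z} → x ≋ y → y ≋ z → x ≋ z
  ≋-trans {x} {y} {z} (mod-p d) (mod-p e) = mod-p (subst (+ p ∣_) (+-minus-telescope x y z) (∣m∣n⇒∣m+n d e))

  ≋-setoid : Setoid _ _
  ≋-setoid = record
    { Carrier = ℤ ; _≈_ = _≋_
    ; isEquivalence = record { refl = ≋-refl ; sym = ≋-sym ; trans = ≋-trans } }

  ≋-+ : ∀ {x x′ y y′} → x ≋ x′ → y ≋ y′ → x + y ≋ x′ + y′
  ≋-+ {x} {x′} {y} {y′} (mod-p d) (mod-p e) = mod-p (subst (+ p ∣_) (sum-sub x x′ y y′) (∣m∣n⇒∣m+n d e))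
    where
    sum-sub : ∀ x x′ y y′ → (x - x′) + (y - y′) ≡ (x + y) - (x′ + y′)
    sum-sub = solve-∀

  ≋-* : ∀ {x x′ y y′} → x ≋ x′ → y ≋ y′ → x * y ≋ x′ * y′
  ≋-* {x} {x′} {y} {y′} (mod-p d) (mod-p e) =
    mod-p (subst (+ p ∣_) (product-sub x x′ y y′) (∣m∣n⇒∣m+n (∣m⇒∣m*n y d) (∣n⇒∣m*n x′ e)))
    where
    product-sub : ∀ x x′ y y′ → (x - x′) * y + x′ * (y - y′) ≡ x * y - x′ * y′
    product-sub = solve-∀

  ≋-^ : ∀ {x y} k → x ≋ y → x ^ k ≋ y ^ k
  ≋-^ zero x≋y = ≋-refl
  ≋-^ (suc k) x≋y = ≋-* x≋y (≋-^ k x≋y)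

  ≋-neg : ∀ {x y} → x ≋ y → - x ≋ - y
  ≋-neg {x} {y} (mod-p d) = mod-p (subst (+ p ∣_) (neg-sub x y) (∣m⇒∣-m d))
    where
    neg-sub : ∀ x y → - (x - y) ≡ - x - - y
    neg-sub = solve-∀

  ≋0-nonzero : ∀ {x} → ¬ x ≋ 0ℤ → x ≢ 0ℤ
  ≋0-nonzero x≢0 x≡0 = x≢0 (≋-reflexive x≡0)

  ∣⇒≋0 : ∀ {x} → + p ∣ x → x ≋ 0ℤ
  ∣⇒≋0 {x} d = mod-p (subst (+ p ∣_) (sym (+-identityʳ x)) d)

  ≋0⇒∣ : ∀ {x} → x ≋ 0ℤ → p ℕ.∣ ∣ x ∣
  ≋0⇒∣ {x} (mod-p d) = ∣⇒∣ᵤ (subst (+ p ∣_) (+-identityʳ x) d)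

  module ≋-Reasoning = Relation.Binary.Reasoning.Setoid ≋-setoid

  ≋-moveʳ : ∀ {x y z} → x + y ≋ z → x ≋ z - y
  ≋-moveʳ {x} {y} {z} x+y≋z = begin
    x            ≡⟨ [x+y]-y≡x x y ⟨
    (x + y) - y  ≈⟨ ≋-+ x+y≋z (≋-refl { - y}) ⟩
    z - y        ∎
    where
    open ≋-Reasoning
    [x+y]-y≡x : ∀ x y → (x + y) - y ≡ x
    [x+y]-y≡x = solve-∀

  ≋0-* : Prime p → ∀ x y → x * y ≋ 0ℤ → x ≋ 0ℤ ⊎ y ≋ 0ℤ
  ≋0-* p-prime x y xy≋0 with euclidsLemma ∣ x ∣ ∣ y ∣ p-prime (subst (p ℕ.∣_) (abs-* x y) (≋0⇒∣ xy≋0))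
  ... | inj₁ p∣x = inj₁ (∣⇒≋0 (∣ᵤ⇒∣ p∣x))
  ... | inj₂ p∣y = inj₂ (∣⇒≋0 (∣ᵤ⇒∣ p∣y))

  ≋0-^ : Prime p → ∀ x k → x ^ k ≋ 0ℤ → x ≋ 0ℤ
  ≋0-^ p-prime x zero 1≋0 = ⊥-elim (prime∤1 p-prime (≋0⇒∣ 1≋0))
  ≋0-^ p-prime x (suc k) xxᵏ≋0 = [ id , ≋0-^ p-prime x k ]′ (≋0-* p-prime x (x ^ k) xxᵏ≋0)

  ≋-cancelʳ : Prime p → ∀ {x y z} → ¬ z ≋ 0ℤ → x * z ≋ y * z → x ≋ y
  ≋-cancelʳ p-prime {x} {y} {z} z≢0 xz≋yz
    with ≋0-* p-prime (x - y) z (∣⇒≋0 (subst (+ p ∣_) (factor-sub x y z) (p∣x-y xz≋yz)))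
    where
    factor-sub : ∀ x y z → x * z - y * z ≡ (x - y) * z
    factor-sub = solve-∀
  ... | inj₁ x-y≋0 = mod-p (subst (+ p ∣_) (+-identityʳ (x - y)) (p∣x-y x-y≋0))
  ... | inj₂ z≋0 = ⊥-elim (z≢0 z≋0)

  p≡1+[p∸1] : Prime p → p ≡ suc (p ℕ.∸ 1)
  p≡1+[p∸1] p-prime = sym (ℕ.suc-pred p {{prime⇒nonZero p-prime}})

  -- The algebra library's binomial theorem is stated with its own powers and
  -- multiples; on ℤ they agree with _^_ and with multiplication by + k.
  private
    module Exp = Algebra.Properties.Semiring.Exp (CommutativeSemiring.semiring +-*-commutativeSemiring)
    module Mult = Algebra.Definitions.RawMonoid +-0-rawMonoid
  open Mult using (sum)

  ^ᴬ≡^ : ∀ x k → x Exp.^ k ≡ x ^ k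
  ^ᴬ≡^ x zero = refl
  ^ᴬ≡^ x (suc k) = cong (x *_) (^ᴬ≡^ x k)

  ×≡* : ∀ k x → k Mult.× x ≡ + k * x
  ×≡* zero x = refl
  ×≡* (suc k) x = trans (cong (λ t → x + t) (×≡* k x)) (sym (suc-* (+ k) x))

  sum≋last : ∀ q (t : Vector ℤ (suc q)) → (∀ i → t (inject₁ i) ≋ 0ℤ) → sum t ≋ t (fromℕ q)
  sum≋last zero t _ = ≋-reflexive (+-identityʳ (t zero))
  sum≋last (suc q) t vanish = begin
    t zero + sum (tail t)   ≈⟨ ≋-+ (vanish zero) (sum≋last q (tail t) (vanish ∘ suc)) ⟩
    0ℤ + t (fromℕ (suc q))  ≡⟨ +-identityˡ (t (fromℕ (suc q))) ⟩
    t (fromℕ (suc q))       ∎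
    where open ≋-Reasoning

  -- Frobenius: (x + y)^p ≡ x^p + y^p (mod p), since p divides the inner binomial coefficients.
  frobenius : Prime p → ∀ x y → (x + y) ^ p ≋ x ^ p + y ^ p
  frobenius p-prime x y = expand (p ℕ.∸ 1) (p≡1+[p∸1] p-prime)
    where
    term : ∀ n → Fin (suc n) → ℤ
    term = Binomial.binomialTerm x y

    first-term : ∀ n → term n zero ≡ y ^ n
    first-term n = trans (+-identityʳ _) (trans (*-identityˡ _) (^ᴬ≡^ y n))

    last-term : ∀ n → term n (fromℕ n) ≡ x ^ n
    last-term n = begin
      (n C toℕ (fromℕ n)) Mult.× (x Exp.^ toℕ (fromℕ n) * y Exp.^ (n ℕ.∸ toℕ (fromℕ n)))
        ≡⟨ cong (λ k → (n C k) Mult.× (x Exp.^ k * y Exp.^ (n ℕ.∸ k))) (Fin.toℕ-fromℕ n) ⟩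
      (n C n) Mult.× (x Exp.^ n * y Exp.^ (n ℕ.∸ n))
        ≡⟨ cong₂ (λ c k → c Mult.× (x Exp.^ n * y Exp.^ k)) (nCn≡1 n) (ℕ.n∸n≡0 n) ⟩
      x Exp.^ n * 1ℤ + 0ℤ
        ≡⟨ trans (+-identityʳ _) (trans (*-identityʳ _) (^ᴬ≡^ x n)) ⟩
      x ^ n ∎
      where open ≡-Reasoning

    inner-term : ∀ q → p ≡ suc q → ∀ (i : Fin q) → term (suc q) (suc (inject₁ i)) ≋ 0ℤ
    inner-term q refl i = ∣⇒≋0 (subst (+ p ∣_) (sym (×≡* coefficient monomial))
      (∣m⇒∣m*n monomial (∣ᵤ⇒∣ {+ p} {+ coefficient} (prime∣pCk p-prime ℕ.z<s (ℕ.s<s i<q)))))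
      where
      coefficient : ℕ
      coefficient = suc q C suc (toℕ (inject₁ i))
      monomial : ℤ
      monomial = Binomial.binomial x y (suc q) (suc (inject₁ i))
      i<q : toℕ (inject₁ i) ℕ.< q
      i<q = subst (ℕ._< q) (sym (Fin.toℕ-inject₁ i)) (Fin.toℕ<n i)

    expand : ∀ q → p ≡ suc q → (x + y) ^ p ≋ x ^ p + y ^ p
    expand q refl = begin
      (x + y) ^ suc q                            ≡⟨ trans (sym (^ᴬ≡^ (x + y) (suc q))) (Binomial.theorem (suc q) x y) ⟩
      term (suc q) zero + sum (tail (term (suc q)))
        ≈⟨ ≋-+ (≋-refl {term (suc q) zero}) (sum≋last q (tail (term (suc q))) (inner-term q refl)) ⟩
      term (suc q) zero + term (suc q) (fromℕ (suc q)) ≡⟨ cong₂ _+_ (first-term (suc q)) (last-term (suc q)) ⟩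
      y ^ suc q + x ^ suc q                         ≡⟨ +-comm (y ^ suc q) (x ^ suc q) ⟩
      x ^ suc q + y ^ suc q                         ∎
      where open ≋-Reasoning

  -- Fermat's little theorem, first for natural numbers and then for all integers:
  -- x^p ≡ x (mod p).  A negative x is handled by expanding (x + (-x))^p.
  fermat-ℕ : Prime p → ∀ n → (+ n) ^ p ≋ + n
  fermat-ℕ p-prime zero = ≋-reflexive (subst (λ k → 0ℤ ^ k ≡ 0ℤ) (sym (p≡1+[p∸1] p-prime)) refl)
  fermat-ℕ p-prime (suc n) = begin
    (1ℤ + + n) ^ p      ≈⟨ frobenius p-prime 1ℤ (+ n) ⟩
    1ℤ ^ p + (+ n) ^ p  ≈⟨ ≋-+ (≋-reflexive (^-zeroˡ p)) (fermat-ℕ p-prime n) ⟩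
    1ℤ + + n            ∎
    where open ≋-Reasoning

  fermat : Prime p → ∀ x → x ^ p ≋ x
  fermat p-prime (+ n) = fermat-ℕ p-prime n
  fermat p-prime -[1+ n ] = begin
    (- x) ^ p   ≈⟨ ≋-moveʳ [-x]ᵖ+xᵖ≋0 ⟩
    0ℤ - x ^ p  ≈⟨ ≋-+ (≋-refl {0ℤ}) (≋-neg (fermat-ℕ p-prime (suc n))) ⟩
    0ℤ - x      ≡⟨ +-identityˡ (- x) ⟩
    - x         ∎
    where
    x : ℤ
    x = + suc n
    open ≋-Reasoning
    [-x]ᵖ+xᵖ≋0 : (- x) ^ p + x ^ p ≋ 0ℤ
    [-x]ᵖ+xᵖ≋0 = begin
      (- x) ^ p + x ^ p  ≈⟨ ≋-sym (frobenius p-prime (- x) x) ⟩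
      (- x + x) ^ p      ≡⟨ cong (_^ p) (+-inverseˡ x) ⟩
      0ℤ ^ p             ≈⟨ fermat-ℕ p-prime 0 ⟩
      0ℤ                 ∎

  fermat-unit : Prime p → ∀ {x} → ¬ x ≋ 0ℤ → x ^ (p ℕ.∸ 1) ≋ 1ℤ
  fermat-unit p-prime {x} x≢0 = ≋-cancelʳ p-prime x≢0 (begin
    x ^ (p ℕ.∸ 1) * x  ≡⟨ *-comm (x ^ (p ℕ.∸ 1)) x ⟩
    x ^ suc (p ℕ.∸ 1)  ≡⟨ cong (x ^_) (sym (p≡1+[p∸1] p-prime)) ⟩
    x ^ p              ≈⟨ fermat p-prime x ⟩
    x                  ≡⟨ sym (*-identityˡ x) ⟩
    1ℤ * x             ∎)
    where open ≋-Reasoning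

  ≋-^-* : ∀ {u v} k → u ^ k ≋ v ^ k → ∀ x → u ^ (x ℕ.* k) ≋ v ^ (x ℕ.* k)
  ≋-^-* {u} {v} k uᵏ≋vᵏ x = subst₂ _≋_ (power-product u) (power-product v) (≋-^ x uᵏ≋vᵏ)
    where
    power-product : ∀ w → (w ^ k) ^ x ≡ w ^ (x ℕ.* k)
    power-product w = trans (^-*-assoc w k x) (cong (w ^_) (ℕ.*-comm k x))

  ≋-^-cancel : Prime p → ∀ {u v} g k → ¬ v ≋ 0ℤ →
               u ^ (g ℕ.+ k) ≋ v ^ (g ℕ.+ k) → u ^ k ≋ v ^ k → u ^ g ≋ v ^ g
  ≋-^-cancel p-prime {u} {v} g k v≢0 e-sum e-k = ≋-cancelʳ p-prime (v≢0 ∘ ≋0-^ p-prime v k) (begin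
    u ^ g * v ^ k        ≈⟨ ≋-* (≋-refl {u ^ g}) (≋-sym e-k) ⟩
    u ^ g * u ^ k        ≡⟨ sym (^-distribˡ-+-* u g k) ⟩
    u ^ (g ℕ.+ k)        ≈⟨ e-sum ⟩
    v ^ (g ℕ.+ k)        ≡⟨ ^-distribˡ-+-* v g k ⟩
    v ^ g * v ^ k        ∎)
    where open ≋-Reasoning

  -- If u^N ≡ v^N and u^M ≡ v^M with v a unit, then u^gcd(N,M) ≡ v^gcd(N,M):
  -- write gcd(N,M) + yM = xN or gcd(N,M) + xN = yM (Bézout) and cancel.
  ≋-^-gcd : Prime p → ∀ {u v} N M → ¬ v ≋ 0ℤ → u ^ N ≋ v ^ N → u ^ M ≋ v ^ M → u ^ gcd N M ≋ v ^ gcd N M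
  ≋-^-gcd p-prime {u} {v} N M v≢0 e-N e-M with Bézout.identity (gcd-GCD N M)
  ... | Bézout.+- x y g+yM≡xN = ≋-^-cancel p-prime (gcd N M) (y ℕ.* M) v≢0
          (subst (λ k → u ^ k ≋ v ^ k) (sym g+yM≡xN) (≋-^-* N e-N x)) (≋-^-* M e-M y)
  ... | Bézout.-+ x y g+xN≡yM = ≋-^-cancel p-prime (gcd N M) (x ℕ.* N) v≢0
          (subst (λ k → u ^ k ≋ v ^ k) (sym g+xN≡yM) (≋-^-* M e-M y)) (≋-^-* N e-N x)

module PowerSums {p : ℕ} (p-prime : Prime p) where
  open import Data.Nat as ℕ using (suc; z<s)
  import Data.Nat.Properties as ℕ
  import Data.Nat.Divisibility as ℕ
  open import Data.Nat.Primality using (prime⇒irreducible)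
  open import Data.Nat.GCD using (gcd; gcd[m,n]∣m; gcd[m,n]∣n)
  open import Data.Nat.Coprimality as Coprimality using (Coprime)
  open import Data.Integer using (ℤ; +_; 0ℤ; _+_; -_; _*_; _^_; ∣_∣; ≢-nonZero)
  open import Data.Integer.Properties
  open import Data.Integer.Divisibility.Signed using (divides; ∣ᵤ⇒∣)
  open import Data.Integer.Tactic.RingSolver using (solve-∀)
  open import Data.Nat.Tactic.RingSolver using () renaming (solve-∀ to ℕ-solve-∀)
  open import Defs using (gcd3)
  open Naturals using (Odd; PowerTriple; prime⇒1<p; prime∤1; prime-power-divisor; power-too-large;
                       odd∣even⇒2*∣; odd⇒2∣pred; *-positive; *-positive⁻¹; ^-positive; coprime-^;
                       gcd3∣; gcd3-*; cube*p≡^[3k+1])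
  open Integers
  open Modular p

  -- If (a + b) p = a^n + b^n with n odd, n ≥ 3 and a + b ≠ 0, then a and b are coprime:
  -- writing a = A d, b = B d with d = gcd(|a|, |b|) gives p = S d^(n-1) where
  -- A^n + B^n = S (A + B), so d^(n-1) divides the prime p.
  coprime-summands : ∀ {n} → Odd n → 2 ℕ.< n → ∀ a b → a + b ≢ 0ℤ →
                     (a + b) * + p ≡ a ^ n + b ^ n → Coprime ∣ a ∣ ∣ b ∣
  coprime-summands {suc k} n-odd 2<n a b a+b≢0 sum-eq
    with ∣ᵤ⇒∣ {+ gcd ∣ a ∣ ∣ b ∣} {a} (gcd[m,n]∣m ∣ a ∣ ∣ b ∣)
       | ∣ᵤ⇒∣ {+ gcd ∣ a ∣ ∣ b ∣} {b} (gcd[m,n]∣n ∣ a ∣ ∣ b ∣)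
  ... | divides A a≡Ad | divides B b≡Bd with sum∣odd-pow-sum n-odd A B
  ... | divides S Aⁿ+Bⁿ≡S[A+B] = Coprimality.gcd≡1⇒coprime
    (prime-power-divisor p-prime (ℕ.s≤s⁻¹ 2<n) (ℕ.divides ∣ S ∣ p≡∣S∣dᵏ))
    where
    n : ℕ
    n = suc k
    d : ℕ
    d = gcd ∣ a ∣ ∣ b ∣
    D : ℤ
    D = + d
    a+b≡[A+B]D : a + b ≡ (A + B) * D
    a+b≡[A+B]D = trans (cong₂ _+_ a≡Ad b≡Bd) (sym (*-distribʳ-+ D A B))
    regroup : ∀ s t d e → s * t * (d * e) ≡ t * d * (s * e)
    regroup = solve-∀
    scaled : (A + B) * D * + p ≡ (A + B) * D * (S * D ^ k)
    scaled = begin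
      (A + B) * D * + p           ≡⟨ cong (_* + p) a+b≡[A+B]D ⟨
      (a + b) * + p               ≡⟨ sum-eq ⟩
      a ^ n + b ^ n               ≡⟨ cong₂ (λ x y → x ^ n + y ^ n) a≡Ad b≡Bd ⟩
      (A * D) ^ n + (B * D) ^ n   ≡⟨ cong₂ _+_ (^-distribʳ-* A D n) (^-distribʳ-* B D n) ⟩
      A ^ n * D ^ n + B ^ n * D ^ n ≡⟨ *-distribʳ-+ (D ^ n) (A ^ n) (B ^ n) ⟨
      (A ^ n + B ^ n) * D ^ n     ≡⟨ cong (_* D ^ n) Aⁿ+Bⁿ≡S[A+B] ⟩
      S * (A + B) * (D * D ^ k)   ≡⟨ regroup S (A + B) D (D ^ k) ⟩
      (A + B) * D * (S * D ^ k)   ∎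
      where open ≡-Reasoning
    p≡SDᵏ : + p ≡ S * D ^ k
    p≡SDᵏ = *-cancelˡ-≡ ((A + B) * D) (+ p) (S * D ^ k)
      {{≢-nonZero (λ [A+B]D≡0 → a+b≢0 (trans a+b≡[A+B]D [A+B]D≡0))}} scaled
    p≡∣S∣dᵏ : p ≡ ∣ S ∣ ℕ.* d ℕ.^ k
    p≡∣S∣dᵏ = trans (cong ∣_∣ p≡SDᵏ) (trans (abs-* S (D ^ k)) (cong (∣ S ∣ ℕ.*_) (abs-^ D k)))

  p∤summand : ∀ {n} → 0 ℕ.< n → ∀ a b → Coprime ∣ a ∣ ∣ b ∣ → a ^ n + b ^ n ≋ 0ℤ → ¬ a ≋ 0ℤ
  p∤summand {suc k} _ a b a⊥b aⁿ+bⁿ≋0 a≋0 =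
    prime∤1 p-prime (subst (p ℕ.∣_) (a⊥b (≋0⇒∣ a≋0 , ≋0⇒∣ (≋0-^ p-prime b (suc k) bⁿ≋0))) ℕ.∣-refl)
    where
    aⁿ≋0 : a ^ suc k ≋ 0ℤ
    aⁿ≋0 = ≋-* a≋0 (≋-refl {a ^ k})
    bⁿ≋0 : b ^ suc k ≋ 0ℤ
    bⁿ≋0 = ≋-trans (≋-moveʳ (subst (_≋ 0ℤ) (+-comm (a ^ suc k) (b ^ suc k)) aⁿ+bⁿ≋0))
                   (≋-+ (≋-refl {0ℤ}) (≋-neg aⁿ≋0))

  -- If (a + b) p = a^n + b^n and a + b = m^n with m ≠ 0, n odd and n ≥ 3, then p ∤ a + b:
  -- otherwise p ∣ m, so σ = |a + b| ≥ p^n, which contradicts |a + b|^n ≤ 2^n |a^n + b^n| = 2^n σ p.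
  p∤sum : ∀ {n} → Odd n → 2 ℕ.< n → ∀ a b m → m ≢ 0ℤ →
          (a + b) * + p ≡ a ^ n + b ^ n → a + b ≡ m ^ n → ¬ a + b ≋ 0ℤ
  p∤sum {n} n-odd 2<n a b m m≢0 sum-eq a+b≡mⁿ a+b≋0 =
    power-too-large (prime⇒1<p p-prime) 2<n pⁿ≤σ σⁿ≤2ⁿσp
    where
    σ : ℕ
    σ = ∣ a + b ∣
    p≤∣m∣ : p ℕ.≤ ∣ m ∣
    p≤∣m∣ = ℕ.∣⇒≤ {{ℕ.≢-nonZero (m≢0 ∘ ∣i∣≡0⇒i≡0)}}
      (≋0⇒∣ (≋0-^ p-prime m n (subst (_≋ 0ℤ) a+b≡mⁿ a+b≋0)))
    pⁿ≤σ : p ℕ.^ n ℕ.≤ σ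
    pⁿ≤σ = subst (p ℕ.^ n ℕ.≤_) (sym (trans (cong ∣_∣ a+b≡mⁿ) (abs-^ m n))) (ℕ.^-monoˡ-≤ n p≤∣m∣)
    σⁿ≤2ⁿσp : σ ℕ.^ n ℕ.≤ 2 ℕ.^ n ℕ.* (σ ℕ.* p)
    σⁿ≤2ⁿσp = subst (λ t → σ ℕ.^ n ℕ.≤ 2 ℕ.^ n ℕ.* t)
      (trans (cong ∣_∣ (sym sum-eq)) (abs-* (a + b) (+ p)))
      (odd-power-sum-bound n-odd a b)

  -- If p is odd, n is an odd prime, p ∤ a, p ∤ b, p ∤ a + b and p ∣ a^n + b^n, then 2n ∣ p - 1:
  -- a^n ≡ (-b)^n and, by Fermat, a^(p-1) ≡ (-b)^(p-1), so a^g ≡ (-b)^g for g = gcd(n, p - 1);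
  -- g = 1 would give p ∣ a + b, hence g = n.
  2n∣p-1 : Odd p → ∀ {n} → Prime n → Odd n → ∀ a b → ¬ a ≋ 0ℤ → ¬ b ≋ 0ℤ →
           a ^ n + b ^ n ≋ 0ℤ → ¬ a + b ≋ 0ℤ → 2 ℕ.* n ℕ.∣ p ℕ.∸ 1
  2n∣p-1 p-odd {n} n-prime n-odd a b a≢0 b≢0 aⁿ+bⁿ≋0 a+b≢0 =
    [ (λ g≡1 → ⊥-elim (a+b≢0 (a+b≋0 g≡1)))
    , (λ g≡n → odd∣even⇒2*∣ n-odd (odd⇒2∣pred p-odd) (subst (ℕ._∣ M) g≡n (gcd[m,n]∣n n M)))
    ]′ (prime⇒irreducible n-prime (gcd[m,n]∣m n M))
    where
    M g : ℕ
    M = p ℕ.∸ 1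
    g = gcd n M
    -b≢0 : ¬ - b ≋ 0ℤ
    -b≢0 -b≋0 = b≢0 (subst (_≋ 0ℤ) (neg-involutive b) (≋-neg -b≋0))
    aⁿ≋[-b]ⁿ : a ^ n ≋ (- b) ^ n
    aⁿ≋[-b]ⁿ = ≋-trans (≋-moveʳ aⁿ+bⁿ≋0)
      (≋-reflexive (trans (+-identityˡ (- (b ^ n))) (sym (neg-^-odd n-odd b))))
    aᴹ≋[-b]ᴹ : a ^ M ≋ (- b) ^ M
    aᴹ≋[-b]ᴹ = ≋-trans (fermat-unit p-prime a≢0) (≋-sym (fermat-unit p-prime -b≢0))
    aᵍ≋[-b]ᵍ : a ^ g ≋ (- b) ^ g
    aᵍ≋[-b]ᵍ = ≋-^-gcd p-prime n M -b≢0 aⁿ≋[-b]ⁿ aᴹ≋[-b]ᴹ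
    a+b≋0 : g ≡ 1 → a + b ≋ 0ℤ
    a+b≋0 g≡1 = begin
      a + b         ≡⟨ cong (_+ b) (*-identityʳ a) ⟨
      a ^ 1 + b     ≈⟨ ≋-+ (subst (λ e → a ^ e ≋ (- b) ^ e) g≡1 aᵍ≋[-b]ᵍ) (≋-refl {b}) ⟩
      (- b) ^ 1 + b ≡⟨ cong (_+ b) (*-identityʳ (- b)) ⟩
      - b + b       ≡⟨ +-inverseˡ b ⟩
      0ℤ            ∎
      where open ≋-Reasoning

  -- If a^n + b^n = m^n p with a, b, m ≠ 0 coprime and 3k + 1 = e n, then scaling the triple
  -- formed by |a^n|, |b^n| and |m^n p| by p^k gives A + B = C with gcd(A, B, C) = p^k and
  -- ABC = p^(3k+1) |a b m|^n = (p^e |a b m|)^n.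
  scaled-triple : ∀ {n k e} a b m → a ≢ 0ℤ → b ≢ 0ℤ → m ≢ 0ℤ → Coprime ∣ a ∣ ∣ b ∣ →
                  a ^ n + b ^ n ≡ m ^ n * + p → 3 ℕ.* k ℕ.+ 1 ≡ e ℕ.* n → PowerTriple (p ℕ.^ k) n
  scaled-triple {n} {k} {e} a b m a≢0 b≢0 m≢0 a⊥b sum-eq 3k+1≡en =
    K ℕ.* A , K ℕ.* B , K ℕ.* C , p ℕ.^ e ℕ.* (α ℕ.* β ℕ.* μ) ,
    *-positive K>0 A>0 , *-positive K>0 B>0 , *-positive K>0 C>0 ,
    *-positive (^-positive p>0 e) (*-positive (*-positive α>0 β>0) μ>0) ,
    gcd≡K , trans (sym (ℕ.*-distribˡ-+ K A B)) (cong (K ℕ.*_) A+B≡C) , product≡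
    where
    open SumTriple (sum-triple (a ^ n) (b ^ n))
    K α β μ : ℕ
    K = p ℕ.^ k
    α = ∣ a ∣
    β = ∣ b ∣
    μ = ∣ m ∣
    nonzero⇒positive : ∀ {x} → x ≢ 0ℤ → 0 ℕ.< ∣ x ∣
    nonzero⇒positive x≢0 = ℕ.n≢0⇒n>0 (x≢0 ∘ ∣i∣≡0⇒i≡0)
    α>0 : 0 ℕ.< α
    α>0 = nonzero⇒positive a≢0
    β>0 : 0 ℕ.< β
    β>0 = nonzero⇒positive b≢0
    μ>0 : 0 ℕ.< μ
    μ>0 = nonzero⇒positive m≢0
    p>0 : 0 ℕ.< p
    p>0 = ℕ.<-trans z<s (prime⇒1<p p-prime)
    K>0 : 0 ℕ.< K
    K>0 = ^-positive p>0 k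

    ABC≡αⁿβⁿμⁿp : A ℕ.* B ℕ.* C ≡ α ℕ.^ n ℕ.* β ℕ.^ n ℕ.* (μ ℕ.^ n ℕ.* p)
    ABC≡αⁿβⁿμⁿp = trans ABC≡ (cong₂ ℕ._*_ (cong₂ ℕ._*_ (abs-^ a n) (abs-^ b n))
      (trans (cong ∣_∣ sum-eq) (trans (abs-* (m ^ n) (+ p)) (cong (ℕ._* p) (abs-^ m n)))))
    A>0×B>0×C>0 : 0 ℕ.< A × 0 ℕ.< B × 0 ℕ.< C
    A>0×B>0×C>0 with *-positive⁻¹ (A ℕ.* B) C (subst (0 ℕ.<_) (sym ABC≡αⁿβⁿμⁿp)
      (*-positive (*-positive (^-positive α>0 n) (^-positive β>0 n)) (*-positive (^-positive μ>0 n) p>0)))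
    ... | AB>0 , C>0 = proj₁ (*-positive⁻¹ A B AB>0) , proj₂ (*-positive⁻¹ A B AB>0) , C>0
    A>0 : 0 ℕ.< A
    A>0 = proj₁ A>0×B>0×C>0
    B>0 : 0 ℕ.< B
    B>0 = proj₁ (proj₂ A>0×B>0×C>0)
    C>0 : 0 ℕ.< C
    C>0 = proj₂ (proj₂ A>0×B>0×C>0)

    -- gcd(A, B, C) divides |a|^n and |b|^n, which are coprime.
    gcd≡1 : gcd3 A B C ≡ 1
    gcd≡1 with gcd3∣ A B C
    ... | g∣A , g∣B , g∣C with common-divisor g∣A g∣B g∣C
    ... | g∣aⁿ , g∣bⁿ = coprime-^ a⊥b n n
      (subst (gcd3 A B C ℕ.∣_) (abs-^ a n) g∣aⁿ , subst (gcd3 A B C ℕ.∣_) (abs-^ b n) g∣bⁿ)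
    gcd≡K : gcd3 (K ℕ.* A) (K ℕ.* B) (K ℕ.* C) ≡ K
    gcd≡K = trans (gcd3-* K A B C) (trans (cong (K ℕ.*_) gcd≡1) (ℕ.*-identityʳ K))

    factor-out : ∀ K A B C → K ℕ.* A ℕ.* (K ℕ.* B) ℕ.* (K ℕ.* C) ≡ K ℕ.* K ℕ.* K ℕ.* (A ℕ.* B ℕ.* C)
    factor-out = ℕ-solve-∀
    regroup : ∀ K³ x y z p → K³ ℕ.* (x ℕ.* y ℕ.* (z ℕ.* p)) ≡ K³ ℕ.* p ℕ.* (x ℕ.* y ℕ.* z)
    regroup = ℕ-solve-∀
    product≡ : K ℕ.* A ℕ.* (K ℕ.* B) ℕ.* (K ℕ.* C) ≡ (p ℕ.^ e ℕ.* (α ℕ.* β ℕ.* μ)) ℕ.^ n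
    product≡ = begin
      K ℕ.* A ℕ.* (K ℕ.* B) ℕ.* (K ℕ.* C)
        ≡⟨ factor-out K A B C ⟩
      K ℕ.* K ℕ.* K ℕ.* (A ℕ.* B ℕ.* C)
        ≡⟨ cong (K ℕ.* K ℕ.* K ℕ.*_) ABC≡αⁿβⁿμⁿp ⟩
      K ℕ.* K ℕ.* K ℕ.* (α ℕ.^ n ℕ.* β ℕ.^ n ℕ.* (μ ℕ.^ n ℕ.* p))
        ≡⟨ regroup (K ℕ.* K ℕ.* K) (α ℕ.^ n) (β ℕ.^ n) (μ ℕ.^ n) p ⟩
      K ℕ.* K ℕ.* K ℕ.* p ℕ.* (α ℕ.^ n ℕ.* β ℕ.^ n ℕ.* μ ℕ.^ n)
        ≡⟨ cong₂ ℕ._*_ (trans (cube*p≡^[3k+1] p k) (cong (p ℕ.^_) 3k+1≡en)) αⁿβⁿμⁿ≡[αβμ]ⁿ ⟩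
      p ℕ.^ (e ℕ.* n) ℕ.* (α ℕ.* β ℕ.* μ) ℕ.^ n
        ≡⟨ cong (ℕ._* (α ℕ.* β ℕ.* μ) ℕ.^ n) (ℕ.^-*-assoc p e n) ⟨
      (p ℕ.^ e) ℕ.^ n ℕ.* (α ℕ.* β ℕ.* μ) ℕ.^ n
        ≡⟨ Naturals.^-distribʳ-* (p ℕ.^ e) (α ℕ.* β ℕ.* μ) n ⟨
      (p ℕ.^ e ℕ.* (α ℕ.* β ℕ.* μ)) ℕ.^ n ∎
      where
      open ≡-Reasoning
      αⁿβⁿμⁿ≡[αβμ]ⁿ : α ℕ.^ n ℕ.* β ℕ.^ n ℕ.* μ ℕ.^ n ≡ (α ℕ.* β ℕ.* μ) ℕ.^ n
      αⁿβⁿμⁿ≡[αβμ]ⁿ = sym (trans (Naturals.^-distribʳ-* (α ℕ.* β) μ n)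
        (cong (ℕ._* μ ℕ.^ n) (Naturals.^-distribʳ-* α β n)))

open import Defs
open import Data.Nat using (ℕ; _*_; _∸_; _%_; _/_; _<_; _≤_; _^_; _+_)
open import Data.Nat.Primality using (Prime)
open import Data.Nat.Divisibility using (_∣_)
open import Data.Integer as ℤ using (ℤ; +_)
open import Data.Integer.Divisibility as ℤD using ()
open import Data.Sum using (_⊎_)
open import Data.Product using (_×_; ∃-syntax)
open import Relation.Nullary using (¬_)
open import Relation.Binary.PropositionalEquality using (_≡_; _≢_)

theorem5 : (n r : ℕ) → Prime n → 3 < n → (r ≡ 1 ⊎ r ≡ 2) → n % 3 ≡ r →
    (a b m : ℤ) (p : ℕ) → m ≢ ℤ.0ℤ → (a ℤ.+ b) ≢ ℤ.0ℤ →
    (a ℤ.+ b) ℤ.* (+ p) ≡ (a ℤ.^ n) ℤ.+ (b ℤ.^ n) → Prime p → ¬ (2 ∣ p) →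
    (a ℤ.+ b) ≡ m ℤ.^ n →
    ((2 * n) ∣ (p ∸ 1))
    × ((k : ℕ) → 1 ≤ k → (+ n) ℤD.∣ ((+ k) ℤ.- (+ ((r * n ∸ 1) / 3))) →
    ∃[ A ] ∃[ B ] ∃[ C ] ∃[ D ] (1 ≤ A × 1 ≤ B × 1 ≤ C × 1 ≤ D
    × gcd3 A B C ≡ p ^ k × A + B ≡ C × A * B * C ≡ D ^ n))
theorem5 n r n-prime 3<n r∈12 n%3≡r a b m p m≢0 a+b≢0 sum-eq p-prime p-odd a+b≡mⁿ =
  2n∣p-1 p-odd n-prime n-odd a b p∤a p∤b p∣aⁿ+bⁿ p∤a+b , power-triples
  where
  open import Data.Nat using (z<s)
  open import Data.Nat.Properties using (<-trans; n<1+n)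
  open import Data.Nat.Coprimality using (Coprime) renaming (sym to coprime-sym)
  open import Data.Integer.Properties using (+-comm)
  open import Data.Integer.Divisibility.Signed using (divides; ∣ᵤ⇒∣)
  open Naturals using (Odd; PowerTriple; prime⇒odd)
  open Integers using (n∣3k+1)
  open Modular p using (_≋_; ∣⇒≋0; ≋0-nonzero)
  open PowerSums p-prime

  2<n : 2 < n
  2<n = <-trans (n<1+n 2) 3<n
  n-odd : Odd n
  n-odd = prime⇒odd n-prime 2<n
  a⊥b : Coprime (ℤ.∣ a ∣) (ℤ.∣ b ∣)
  a⊥b = coprime-summands n-odd 2<n a b a+b≢0 sum-eq
  p∣aⁿ+bⁿ : a ℤ.^ n ℤ.+ b ℤ.^ n ≋ ℤ.0ℤ
  p∣aⁿ+bⁿ = ∣⇒≋0 (divides (a ℤ.+ b) (sym sum-eq))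
  p∤a : ¬ a ≋ ℤ.0ℤ
  p∤a = p∤summand (<-trans z<s 2<n) a b a⊥b p∣aⁿ+bⁿ
  p∤b : ¬ b ≋ ℤ.0ℤ
  p∤b = p∤summand (<-trans z<s 2<n) b a (coprime-sym a⊥b)
          (subst (_≋ ℤ.0ℤ) (+-comm (a ℤ.^ n) (b ℤ.^ n)) p∣aⁿ+bⁿ)
  p∤a+b : ¬ a ℤ.+ b ≋ ℤ.0ℤ
  p∤a+b = p∤sum n-odd 2<n a b m m≢0 sum-eq a+b≡mⁿ
  power-triples : (k : ℕ) → 1 ≤ k → (+ n) ℤD.∣ ((+ k) ℤ.- (+ ((r * n ∸ 1) / 3))) → PowerTriple (p ^ k) n
  power-triples k _ n∣k-c with n∣3k+1 n r k r∈12 n%3≡r (∣ᵤ⇒∣ n∣k-c)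
  ... | Data.Nat.Divisibility.divides e 3k+1≡en =
    scaled-triple {n} {k} {e} a b m (≋0-nonzero p∤a) (≋0-nonzero p∤b) m≢0 a⊥b
      (trans (sym sum-eq) (cong (ℤ._* + p) a+b≡mⁿ)) 3k+1≡en
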